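{- Let $\Gamma$ be a finite abelian group, let $\kappa$ be a positive integer, and let $\mathcal{K}$ be the number of elements $g\in\Gamma$ with $\kappa g=0$. Let $X\subseteq\Gamma$ with $|X|=x$. Then $$|\langle X\rangle|\le |\Gamma|\cdot\frac{\kappa^{x}}{\mathcal{K}},$$ where $\langle X\rangle$ is the subgroup of $\Gamma$ generated by $X$.
   Context: In the paper, "an element $g$ has order $\kappa$" means $\kappa g=0$ (not necessarily with $\kappa$ minimal); so $\mathcal{K}$ counts all $g$ with $\kappa g=0$. -}

module Defs where

open import Level using (Level; _⊔_; suc)
open import Data.Nat using (ℕ)
open import Data.Fin using (Fin)
open import Data.List using (List; length; filter)
open import Data.List.Base using (allFin)
open import Data.Product using (∃)
open import Relation.Binary.PropositionalEquality using (_≡_)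
open import Relation.Binary.Definitions using (Decidable)
open import Algebra.Bundles using (AbelianGroup)
import Algebra.Definitions.RawMonoid as RM

record FiniteAbelianGroup (c ℓ : Level) : Set (Level.suc (c ⊔ ℓ)) where
  field
    abGroup : AbelianGroup c ℓ
  open AbelianGroup abGroup public
  field
    _≟_       : Decidable _≈_
    order     : ℕ
    elem      : Fin order → Carrier
    elem-surj : ∀ g → ∃ λ i → g ≈ elem i
    elem-inj  : ∀ i j → elem i ≈ elem j → i ≡ j

  _·_ : ℕ → Carrier → Carrier
  n · g = RM._×_ rawMonoid n g

  kernelCount : ℕ → ℕ
  kernelCount κ = length (filter (λ i → (κ · elem i) ≟ ε) (allFin order))

  data ⟨_⟩ {x : ℕ} (X : Fin x → Carrier) : Carrier → Set (c ⊔ ℓ) where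
    gen  : ∀ i → ⟨ X ⟩ (X i)
    zero : ⟨ X ⟩ ε
    add  : ∀ {a b} → ⟨ X ⟩ a → ⟨ X ⟩ b → ⟨ X ⟩ (a ∙ b)
    neg  : ∀ {a} → ⟨ X ⟩ a → ⟨ X ⟩ (a ⁻¹)
    resp : ∀ {a b} → a ≈ b → ⟨ X ⟩ a → ⟨ X ⟩ b

-- Fix κ = k + 1.  Reducing coefficients modulo κ, every element of ⟨ X ⟩ can be
-- written as  ∑ cᵢ Xᵢ + κ h  with  0 ≤ cᵢ < κ  and  h ∈ Γ.  For such an element a,
-- translating h by any z with κ z = 0 gives another representation of a, so the
-- map  (a , z) ↦ (h + z , c)  sends  ⟨ X ⟩ × {z : κ z = 0}  injectively into
-- Γ × {0, …, κ - 1}ˣ.  Hence  |⟨ X ⟩| · 𝒦 ≤ |Γ| · κˣ.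
module Submission where

open import Defs
open import Level using (_⊔_)
open import Data.Nat using (ℕ; zero; suc; _+_; _*_; _^_; _≤_; NonZero)
import Data.Nat.Properties as ℕ
open import Data.Nat.DivMod using (_mod_; _div_; _divMod_; DivMod)
open import Data.Fin using (Fin; zero; suc; toℕ; combine; remQuot; funToFin; finToFun)
open import Data.Fin.Properties
  using (injective⇒≤; combine-injective; combine-remQuot; finToFun-funToFin)
open import Data.List using (List; length; lookup; filter; allFin)
open import Data.List.Membership.Propositional.Properties using (∈-lookup)
open import Data.List.Relation.Unary.All as All using (All)
open import Data.List.Relation.Unary.All.Properties using (all-filter)
open import Data.List.Relation.Unary.AllPairs using (AllPairs; _∷_)
open import Data.List.Relation.Unary.Unique.Setoid using (Unique)
import Data.List.Relation.Unary.Unique.Propositional.Properties as Unique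
open import Data.Product using (∃₂; _×_; _,_; proj₁; proj₂; uncurry)
open import Data.Product.Properties using (,-injective)
open import Function using (_∘_)
open import Function.Definitions using (Injective)
open import Relation.Nullary using (¬_; contradiction)
open import Relation.Binary.Bundles using (Setoid)
open import Relation.Binary.PropositionalEquality as ≡ using (_≡_)
open import Algebra.Bundles using (AbelianGroup)

module _ {a ℓ} (S : Setoid a ℓ) where
  open Setoid S using (_≈_; sym)

  Unique-lookup-injective : ∀ {xs} → Unique S xs →
                            ∀ i j → lookup xs i ≈ lookup xs j → i ≡ j
  Unique-lookup-injective (_   ∷ _)    zero    zero    _  = ≡.refl
  Unique-lookup-injective (x≉ ∷ _)    zero    (suc j) eq = contradiction eq (All.lookup x≉ (∈-lookup j))
  Unique-lookup-injective (x≉ ∷ _)    (suc i) zero    eq = contradiction (sym eq) (All.lookup x≉ (∈-lookup i))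
  Unique-lookup-injective (_   ∷ xs!) (suc i) (suc j) eq = ≡.cong suc (Unique-lookup-injective xs! i j eq)

funToFin-injective : ∀ {m n} (f g : Fin m → Fin n) → funToFin f ≡ funToFin g → ∀ i → f i ≡ g i
funToFin-injective f g eq i = begin
  f i                      ≡⟨ finToFun-funToFin f i ⟨
  finToFun (funToFin f) i  ≡⟨ ≡.cong (λ e → finToFun e i) eq ⟩
  finToFun (funToFin g) i  ≡⟨ finToFun-funToFin g i ⟩
  g i                      ∎
  where open ≡.≡-Reasoning

×-injection⇒*≤ : ∀ {m n p q} (f : Fin m × Fin n → Fin p × Fin q) →
                 Injective _≡_ _≡_ f → m * n ≤ p * q
×-injection⇒*≤ {m} {n} {p} {q} f f-injective = injective⇒≤ flattened-injective
  where
  flattened : Fin (m * n) → Fin (p * q)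
  flattened = uncurry combine ∘ f ∘ remQuot {m} n

  flattened-injective : Injective _≡_ _≡_ flattened
  flattened-injective {i} {j} eq = begin
    i                                  ≡⟨ combine-remQuot {m} n i ⟨
    uncurry combine (remQuot {m} n i)  ≡⟨ ≡.cong (uncurry combine) (f-injective same-image) ⟩
    uncurry combine (remQuot {m} n j)  ≡⟨ combine-remQuot {m} n j ⟩
    j                                  ∎
    where
    open ≡.≡-Reasoning
    same-image : f (remQuot {m} n i) ≡ f (remQuot {m} n j)
    same-image = uncurry (≡.cong₂ _,_) (combine-injective _ _ _ _ eq)

module LinearCombinations {c ℓ} (G : AbelianGroup c ℓ) where
  open AbelianGroup G
  open import Algebra.Definitions.RawMonoid rawMonoid using () renaming (_×_ to _·_)
  open import Algebra.Properties.Group group using (inverseʳ-unique)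
  open import Algebra.Properties.AbelianGroup G using (⁻¹-∙-comm)
  open import Algebra.Properties.Monoid.Mult monoid using (×-congʳ; ×-homo-+; ×-assocˡ)
  open import Algebra.Properties.CommutativeMonoid.Mult commutativeMonoid using (×-distrib-+)
  open import Algebra.Properties.CommutativeMonoid.Sum commutativeMonoid
    using (sum; sum-cong-≋; sum-replicate-zero; ∑-distrib-+)
  open import Algebra.Properties.CommutativeSemigroup commutativeSemigroup using (x∙yz≈y∙xz; interchange)
  open import Relation.Binary.Reasoning.Setoid setoid

  ·-ε : ∀ n → n · ε ≈ ε
  ·-ε zero    = refl
  ·-ε (suc n) = trans (identityˡ _) (·-ε n)

  ·-⁻¹ : ∀ n a → n · (a ⁻¹) ≈ (n · a) ⁻¹
  ·-⁻¹ n a = inverseʳ-unique (n · a) (n · (a ⁻¹)) (begin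
    n · a ∙ n · (a ⁻¹)  ≈⟨ ×-distrib-+ a (a ⁻¹) n ⟨
    n · (a ∙ a ⁻¹)      ≈⟨ ×-congʳ n (inverseʳ a) ⟩
    n · ε               ≈⟨ ·-ε n ⟩
    ε                   ∎)

  ·-sum : ∀ t {m} (f : Fin m → Carrier) → t · sum f ≈ sum (λ i → t · f i)
  ·-sum t {zero}  f = ·-ε t
  ·-sum t {suc m} f = trans (×-distrib-+ (f zero) (sum (f ∘ suc)) t) (∙-congˡ (·-sum t (f ∘ suc)))

  ⁻¹≈·∙suc·⁻¹ : ∀ k a → a ⁻¹ ≈ k · a ∙ suc k · (a ⁻¹)
  ⁻¹≈·∙suc·⁻¹ k a = sym (begin
    k · a ∙ (a ⁻¹ ∙ k · (a ⁻¹))  ≈⟨ x∙yz≈y∙xz _ _ _ ⟩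
    a ⁻¹ ∙ (k · a ∙ k · (a ⁻¹))  ≈⟨ ∙-congˡ (∙-congˡ (·-⁻¹ k a)) ⟩
    a ⁻¹ ∙ (k · a ∙ (k · a) ⁻¹)  ≈⟨ ∙-congˡ (inverseʳ (k · a)) ⟩
    a ⁻¹ ∙ ε                     ≈⟨ identityʳ _ ⟩
    a ⁻¹                         ∎)

  ·-absorbs-torsion : ∀ n h {z} → n · z ≈ ε → n · h ≈ n · (h ∙ z)
  ·-absorbs-torsion n h {z} nz≈ε = begin
    n · h          ≈⟨ identityʳ _ ⟨
    n · h ∙ ε      ≈⟨ ∙-congˡ nz≈ε ⟨
    n · h ∙ n · z  ≈⟨ ×-distrib-+ h z n ⟨
    n · (h ∙ z)    ∎

  linComb : ∀ {m} → (Fin m → ℕ) → (Fin m → Carrier) → Carrier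
  linComb n Y = sum (λ i → n i · Y i)

  linComb-cong : ∀ {m} {n n′ : Fin m → ℕ} Y → (∀ i → n i ≡ n′ i) → linComb n Y ≈ linComb n′ Y
  linComb-cong Y n≗n′ = sum-cong-≋ (λ i → reflexive (≡.cong (_· Y i) (n≗n′ i)))

  linComb-0 : ∀ {m} (Y : Fin m → Carrier) → linComb (λ _ → 0) Y ≈ ε
  linComb-0 {m} Y = sum-replicate-zero m

  linComb-+ : ∀ {m} (n n′ : Fin m → ℕ) Y →
              linComb (λ i → n i + n′ i) Y ≈ linComb n Y ∙ linComb n′ Y
  linComb-+ n n′ Y = trans (sum-cong-≋ (λ i → ×-homo-+ (Y i) (n i) (n′ i))) (∑-distrib-+ (λ i → n i · Y i) (λ i → n′ i · Y i))

  linComb-* : ∀ {m} t (n : Fin m → ℕ) Y → linComb (λ i → t * n i) Y ≈ t · linComb n Y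
  linComb-* t n Y = trans (sum-cong-≋ (λ i → sym (×-assocˡ (Y i) t (n i)))) (sym (·-sum t (λ i → n i · Y i)))

  δ : ∀ {m} → Fin m → Fin m → ℕ
  δ zero    zero    = 1
  δ zero    (suc j) = 0
  δ (suc i) zero    = 0
  δ (suc i) (suc j) = δ i j

  linComb-δ : ∀ {m} (i : Fin m) Y → linComb (δ i) Y ≈ Y i
  linComb-δ zero    Y = trans (∙-cong (identityʳ _) (linComb-0 (Y ∘ suc))) (identityʳ _)
  linComb-δ (suc i) Y = trans (identityˡ _) (linComb-δ i (Y ∘ suc))

  module _ (k : ℕ) {x} (X : Fin x → Carrier) where

    Decomposition : Carrier → Set (c ⊔ ℓ)
    Decomposition a = ∃₂ λ (n : Fin x → ℕ) h → a ≈ linComb n X ∙ suc k · h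

    ReducedDecomposition : Carrier → Set (c ⊔ ℓ)
    ReducedDecomposition a = ∃₂ λ (r : Fin x → Fin (suc k)) h → a ≈ linComb (toℕ ∘ r) X ∙ suc k · h

    Decomposition-resp-≈ : ∀ {a b} → a ≈ b → Decomposition a → Decomposition b
    Decomposition-resp-≈ a≈b (n , h , eq) = n , h , trans (sym a≈b) eq

    Decomposition-ε : Decomposition ε
    Decomposition-ε = (λ _ → 0) , ε , sym (begin
      linComb (λ _ → 0) X ∙ suc k · ε  ≈⟨ ∙-cong (linComb-0 X) (·-ε (suc k)) ⟩
      ε ∙ ε                            ≈⟨ identityʳ ε ⟩
      ε                                ∎)

    Decomposition-gen : ∀ i → Decomposition (X i)
    Decomposition-gen i = δ i , ε , sym (begin
      linComb (δ i) X ∙ suc k · ε  ≈⟨ ∙-cong (linComb-δ i X) (·-ε (suc k)) ⟩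
      X i ∙ ε                      ≈⟨ identityʳ (X i) ⟩
      X i                          ∎)

    Decomposition-∙ : ∀ {a b} → Decomposition a → Decomposition b → Decomposition (a ∙ b)
    Decomposition-∙ {a} {b} (n , h , a≈) (n′ , h′ , b≈) = (λ i → n i + n′ i) , h ∙ h′ , (begin
      a ∙ b
        ≈⟨ ∙-cong a≈ b≈ ⟩
      (linComb n X ∙ suc k · h) ∙ (linComb n′ X ∙ suc k · h′)
        ≈⟨ interchange _ _ _ _ ⟩
      (linComb n X ∙ linComb n′ X) ∙ (suc k · h ∙ suc k · h′)
        ≈⟨ ∙-cong (linComb-+ n n′ X) (×-distrib-+ h h′ (suc k)) ⟨
      linComb (λ i → n i + n′ i) X ∙ suc k · (h ∙ h′)
        ∎)

    -- Modulo suc k · Γ, negation is multiplication by k, so ℕ-coefficients suffice.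
    Decomposition-⁻¹ : ∀ {a} → Decomposition a → Decomposition (a ⁻¹)
    Decomposition-⁻¹ {a} (n , h , a≈) = (λ i → k * n i) , linComb n X ⁻¹ ∙ h ⁻¹ , (begin
      a ⁻¹
        ≈⟨ ⁻¹-cong a≈ ⟩
      (linComb n X ∙ suc k · h) ⁻¹
        ≈⟨ ⁻¹-∙-comm _ _ ⟨
      linComb n X ⁻¹ ∙ (suc k · h) ⁻¹
        ≈⟨ ∙-cong (⁻¹≈·∙suc·⁻¹ k (linComb n X)) (sym (·-⁻¹ (suc k) h)) ⟩
      (k · linComb n X ∙ suc k · (linComb n X ⁻¹)) ∙ suc k · (h ⁻¹)
        ≈⟨ assoc _ _ _ ⟩
      k · linComb n X ∙ (suc k · (linComb n X ⁻¹) ∙ suc k · (h ⁻¹))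
        ≈⟨ ∙-cong (linComb-* k n X) (×-distrib-+ _ _ (suc k)) ⟨
      linComb (λ i → k * n i) X ∙ suc k · (linComb n X ⁻¹ ∙ h ⁻¹)
        ∎)

    reduce : ∀ {a} → Decomposition a → ReducedDecomposition a
    reduce {a} (n , h , a≈) = (λ i → n i mod suc k) , linComb (λ i → n i div suc k) X ∙ h , (begin
      a
        ≈⟨ a≈ ⟩
      linComb n X ∙ suc k · h
        ≈⟨ ∙-congʳ (linComb-cong X division) ⟩
      linComb (λ i → remainders i + suc k * (n i div suc k)) X ∙ suc k · h
        ≈⟨ ∙-congʳ (linComb-+ remainders (λ i → suc k * (n i div suc k)) X) ⟩
      (linComb remainders X ∙ linComb (λ i → suc k * (n i div suc k)) X) ∙ suc k · h
        ≈⟨ ∙-congʳ (∙-congˡ (linComb-* (suc k) (λ i → n i div suc k) X)) ⟩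
      (linComb remainders X ∙ suc k · quotients) ∙ suc k · h
        ≈⟨ assoc _ _ _ ⟩
      linComb remainders X ∙ (suc k · quotients ∙ suc k · h)
        ≈⟨ ∙-congˡ (×-distrib-+ _ _ (suc k)) ⟨
      linComb remainders X ∙ suc k · (quotients ∙ h)
        ∎)
      where
      remainders : Fin x → ℕ
      remainders i = toℕ (n i mod suc k)
      quotients : Carrier
      quotients = linComb (λ i → n i div suc k) X
      division : ∀ i → n i ≡ remainders i + suc k * (n i div suc k)
      division i = ≡.trans (DivMod.property (n i divMod suc k))
                           (≡.cong (remainders i +_) (ℕ.*-comm (n i div suc k) (suc k)))

module _ {c ℓ} (Γ : FiniteAbelianGroup c ℓ) (k : ℕ) where
  open FiniteAbelianGroup Γ
  open LinearCombinations abGroup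
  open import Algebra.Properties.Group group using (∙-cancelˡ)
  open import Algebra.Properties.Monoid.Mult monoid using (×-congʳ)
  open import Relation.Binary.Reasoning.Setoid setoid

  private
    κ : ℕ
    κ = suc k

  ⟨⟩⇒ReducedDecomposition : ∀ {x} {X : Fin x → Carrier} {a} → ⟨ X ⟩ a → ReducedDecomposition k X a
  ⟨⟩⇒ReducedDecomposition = reduce k _ ∘ decompose
    where
    decompose : ∀ {x} {X : Fin x → Carrier} {a} → ⟨ X ⟩ a → Decomposition k X a
    decompose (gen i)     = Decomposition-gen k _ i
    decompose zero        = Decomposition-ε k _
    decompose (add a b)   = Decomposition-∙ k _ (decompose a) (decompose b)
    decompose (neg a)     = Decomposition-⁻¹ k _ (decompose a)
    decompose (resp eq a) = Decomposition-resp-≈ k _ eq (decompose a)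

  kernel : List (Fin order)
  kernel = filter (λ i → (κ · elem i) ≟ ε) (allFin order)

  kernelElement : Fin (length kernel) → Carrier
  kernelElement j = elem (lookup kernel j)

  kernelElement-injective : ∀ j j′ → kernelElement j ≈ kernelElement j′ → j ≡ j′
  kernelElement-injective j j′ =
    Unique-lookup-injective (≡.setoid _) (Unique.filter⁺ _ (Unique.allFin⁺ order)) j j′ ∘ elem-inj _ _

  κ·kernelElement≈ε : ∀ j → κ · kernelElement j ≈ ε
  κ·kernelElement≈ε j = All.lookup (all-filter (λ i → (κ · elem i) ≟ ε) (allFin order)) (∈-lookup j)

  index : Carrier → Fin order
  index g = proj₁ (elem-surj g)

  index-injective : ∀ {g h} → index g ≡ index h → g ≈ h
  index-injective {g} {h} eq =
    trans (proj₂ (elem-surj g)) (trans (reflexive (≡.cong elem eq)) (sym (proj₂ (elem-surj h))))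

  module _ {x} (X : Fin x → Carrier) (L : List Carrier) (L-unique : Unique setoid L) (L⊆⟨X⟩ : All ⟨ X ⟩ L) where
    private
      decomposition : ∀ i → ReducedDecomposition k X (lookup L i)
      decomposition i = ⟨⟩⇒ReducedDecomposition (All.lookup L⊆⟨X⟩ (∈-lookup i))

      coefficients : Fin (length L) → Fin x → Fin κ
      coefficients i = proj₁ (decomposition i)

      cofactor : Fin (length L) → Carrier
      cofactor i = proj₁ (proj₂ (decomposition i))

      lookup-decomposition : ∀ i j →
        lookup L i ≈ linComb (toℕ ∘ coefficients i) X ∙ κ · (cofactor i ∙ kernelElement j)
      lookup-decomposition i j =
        trans (proj₂ (proj₂ (decomposition i))) (∙-congˡ (·-absorbs-torsion κ (cofactor i) (κ·kernelElement≈ε j)))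

    encode : Fin (length L) × Fin (length kernel) → Fin order × Fin (κ ^ x)
    encode (i , j) = index (cofactor i ∙ kernelElement j) , funToFin (coefficients i)

    encode-injectiveˡ : ∀ {i j i′ j′} → encode (i , j) ≡ encode (i′ , j′) → i ≡ i′
    encode-injectiveˡ {i} {j} {i′} {j′} eq = Unique-lookup-injective setoid L-unique i i′ (begin
      lookup L i
        ≈⟨ lookup-decomposition i j ⟩
      linComb (toℕ ∘ coefficients i) X ∙ κ · (cofactor i ∙ kernelElement j)
        ≈⟨ ∙-cong (linComb-cong X (≡.cong toℕ ∘ same-coefficients)) (×-congʳ κ same-sum) ⟩
      linComb (toℕ ∘ coefficients i′) X ∙ κ · (cofactor i′ ∙ kernelElement j′)
        ≈⟨ lookup-decomposition i′ j′ ⟨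
      lookup L i′ ∎)
      where
      same-sum : cofactor i ∙ kernelElement j ≈ cofactor i′ ∙ kernelElement j′
      same-sum = index-injective (proj₁ (,-injective eq))
      same-coefficients : ∀ t → coefficients i t ≡ coefficients i′ t
      same-coefficients = funToFin-injective (coefficients i) (coefficients i′) (proj₂ (,-injective eq))

    encode-injectiveʳ : ∀ {i j j′} → encode (i , j) ≡ encode (i , j′) → j ≡ j′
    encode-injectiveʳ {i} {j} {j′} eq =
      kernelElement-injective j j′ (∙-cancelˡ (cofactor i) _ _ (index-injective (proj₁ (,-injective eq))))

    encode-injective : Injective _≡_ _≡_ encode
    encode-injective {i , _} {_ , _} eq with ≡.refl ← encode-injectiveˡ eq = ≡.cong (i ,_) (encode-injectiveʳ eq)

lemma9p3 : ∀ {c ℓ} (Γ : FiniteAbelianGroup c ℓ) (κ : ℕ) → .{{_ : NonZero κ}} →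
    let open FiniteAbelianGroup Γ in
    (x : ℕ) (X : Fin x → Carrier) → (∀ i j → X i ≈ X j → i ≡ j) →
    (L : List Carrier) → AllPairs (λ a b → ¬ (a ≈ b)) L → All ⟨ X ⟩ L →
    length L * kernelCount κ ≤ order * κ ^ x
lemma9p3 Γ (suc k) x X _ L L-unique L⊆⟨X⟩ =
  ×-injection⇒*≤ (encode Γ k X L L-unique L⊆⟨X⟩) (encode-injective Γ k X L L-unique L⊆⟨X⟩)
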